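{- Let $(G,\cdot)$ be a finite abelian group of order $n$, let $l,m\ge 2$, let $c\in\{1,\dots,m-1\}$, and let $\{A_0,\dots,A_{m-1}\}$ be a family of $m$ pairwise disjoint subsets of $G$ with $|A_i|=l$ for all $i$ (subscripts modulo $m$). Put $t=\gcd(c,m)$, $c'=c/t$, $m'=m/t$, and for $0\le i\le t-1$ let $$\mathcal{D}^{(i)}=\{D_0^{(i)}=A_i,\ D_1^{(i)}=A_{i+t},\ \dots,\ D_{m'-1}^{(i)}=A_{i+(m'-1)t}\}.$$ Then $\{A_0,\dots,A_{m-1}\}$ is an $(n,m,l;\lambda)$-$c$-SCEDF in $G$ if and only if for every $0\le i\le t-1$, the family $\mathcal{D}^{(i)}$ is an $(n,m',l;\lambda)$-$c'$-SCEDF in $G$.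
   Context: Let $(G,\cdot)$ be a finite abelian group of order $n$, $l,m\ge 2$, $c\in\{1,\dots,m-1\}$. For subsets $A,B\subseteq G$, $\Delta(A,B)$ is the multiset $\{\{ab^{ -1}: a\in A, b\in B\}\}$. A family $\{A_0,\dots,A_{m-1}\}$ of $m$ pairwise disjoint subsets of $G$ is an $(n,m,l;\lambda)$-$c$-strong circular external difference family (SCEDF) in $G$ if $|A_i|=l$ for all $i$ and, for every $0\le i\le m-1$, each element $g\ne 1_G$ occurs exactly $\lambda$ times in $\Delta(A_{i+c},A_i)$ (and $1_G$ does not occur), i.e. $A_{i+c}A_i^{(-1)}=\lambda(G-1_G)$ in the group ring $\mathbb{Z}[G]$, with subscripts modulo $m$. -}

module Defs where

open import Level using (0ℓ)
open import Algebra.Bundles using (AbelianGroup)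
open import Data.Nat using (ℕ; zero; suc; _+_; _*_; _≤_; _<_)
open import Data.Nat.DivMod using (_mod_)
open import Data.Fin using (Fin; toℕ)
open import Data.Fin.Subset using (Subset; ⊥; _∈_; ∣_∣)
open import Data.List using (List; map; allFin; length)
open import Data.Nat.ListAction using (sum)
open import Data.Bool using (Bool; true; false; _∧_; if_then_else_)
open import Data.Vec using (lookup)
open import Data.Product using (_×_; Σ)
open import Relation.Binary.PropositionalEquality using (_≡_; _≢_)
open import Relation.Binary.Definitions using (Decidable)
open import Relation.Nullary using (¬_; does)

record FiniteAbelianGroup (n : ℕ) : Set₁ where
  field
    abGroup : AbelianGroup 0ℓ 0ℓ
  open AbelianGroup abGroup public
  field
    _≟_       : Decidable _≈_
    enum      : Fin n → Carrier
    enum-inj  : ∀ i j → enum i ≈ enum j → i ≡ j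
    enum-surj : ∀ g → Σ (Fin n) (λ i → enum i ≈ g)

module _ {n : ℕ} (G : FiniteAbelianGroup n) where
  open FiniteAbelianGroup G

  -- subsets of G are subsets of the index set Fin n (via enum)

  mult : Subset n → Subset n → Carrier → ℕ
  mult A B g =
    sum (map (λ i → sum (map (λ j →
           if lookup A i ∧ lookup B j ∧ does ((enum i ∙ (enum j) ⁻¹) ≟ g)
           then 1 else 0) (allFin n))) (allFin n))

  -- subscripts modulo m (the m = 0 case never arises since m ≥ 2)
  fam : {m : ℕ} → (Fin m → Subset n) → ℕ → Subset n
  fam {zero}  A k = ⊥
  fam {suc r} A k = A (k mod suc r)

  IsSCEDF : (m l lam c : ℕ) → (Fin m → Subset n) → Set
  IsSCEDF m l lam c A =
      (2 ≤ l) × (2 ≤ m) × (1 ≤ c) × (c < m)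
    × (∀ i j → i ≢ j → ∀ x → x ∈ A i → x ∈ A j → Data.Empty.⊥)
    × (∀ i → ∣ A i ∣ ≡ l)
    × (∀ (i : Fin m) (g : Carrier) →
          (g ≈ ε → mult (fam A (toℕ i + c)) (A i) g ≡ 0)
        × (¬ (g ≈ ε) → mult (fam A (toℕ i + c)) (A i) g ≡ lam))
    where import Data.Empty

  subfam : {m : ℕ} → (Fin m → Subset n) → (t i : ℕ) → (m' : ℕ) → Fin m' → Subset n
  subfam A t i m' j = fam A (i + toℕ j * t)

{-# OPTIONS --safe #-}
module Submission where

-- An index k < m′ t is uniquely k = i + j t with i < t and j < m′, and adding
-- c = c′ t modulo m′ t keeps i and moves j to j + c′ modulo m′. So the
-- c-difference condition of the family at A_k is literally the c′-difference
-- condition of 𝒟^(i) at D_j^(i), and the two sets of conditions coincide.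

open import Defs
open import Data.Nat using (ℕ; zero; suc; _+_; _*_; _≤_; _<_; z<s; s<s; NonZero)
open import Data.Nat.Properties
open import Data.Nat.DivMod
open import Data.Nat.GCD using (gcd)
open import Data.Fin using (Fin; zero; toℕ; fromℕ<)
open import Data.Fin.Properties using (toℕ-fromℕ<; toℕ-injective; toℕ<n)
open import Data.Fin.Subset using (Subset; _∈_; ∣_∣)
open import Data.Empty using (⊥)
open import Data.Product using (_×_; _,_; ∃₂)
open import Function.Bundles using (_⇔_; mk⇔)
open import Relation.Binary.PropositionalEquality
open import Relation.Nullary using (¬_)

toℕ-mod : ∀ x d .{{_ : NonZero d}} → toℕ (x mod d) ≡ x % d
toℕ-mod x d = toℕ-fromℕ< (m%n<n x d)

[m+n*o]%[p*o]≡m+n%p*o : ∀ {m o} n p .{{_ : NonZero p}} .{{_ : NonZero (p * o)}} →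
                        m < o → (m + n * o) % (p * o) ≡ m + n % p * o
[m+n*o]%[p*o]≡m+n%p*o {m} {o} n p m<o = begin
  (m + n * o) % (p * o)   ≡⟨ %-congˡ (+-comm m (n * o)) ⟩
  (n * o + m) % (p * o)   ≡⟨ [m*n+o]%[p*n]≡[m*n]%[p*n]+o n p m<o ⟩
  n * o % (p * o) + m     ≡⟨ cong (_+ m) (m%n*o≡m*o%[n*o] n p o) ⟨
  n % p * o + m           ≡⟨ +-comm (n % p * o) m ⟩
  m + n % p * o           ∎
  where open ≡-Reasoning

0<m*n⇒0<m : ∀ m {n} → 0 < m * n → 0 < m
0<m*n⇒0<m (suc _) _ = z<s

module _ {n : ℕ} (G : FiniteAbelianGroup n) where
  open FiniteAbelianGroup G using (_≈_; ε)

  HasConstantDifferences : ℕ → Subset n → Subset n → Set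
  HasConstantDifferences lam X Y =
    ∀ g → (g ≈ ε → mult G X Y g ≡ 0) × (¬ (g ≈ ε) → mult G X Y g ≡ lam)

  sizes : ∀ {m l lam c A} → IsSCEDF G m l lam c A → ∀ i → ∣ A i ∣ ≡ l
  sizes (_ , _ , _ , _ , _ , size , _) = size

  differences : ∀ {m l lam c A} → IsSCEDF G m l lam c A →
                ∀ i → HasConstantDifferences lam (fam G A (toℕ i + c)) (A i)
  differences (_ , _ , _ , _ , _ , _ , diff) = diff

  -- m′ = 1 + r and t = 1 + s, so that  fam  on Fin (m′ * t) reduces to  _mod m.
  module Blocks (r s : ℕ) where
    m′ : ℕ
    m′ = suc r

    t : ℕ
    t = suc s

    m : ℕ
    m = m′ * t

    block : Fin t → Fin m′ → Fin m
    block i j = (toℕ i + toℕ j * t) mod m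

    toℕ-block : ∀ i j → toℕ (block i j) ≡ toℕ i + toℕ j * t
    toℕ-block i j = begin
      toℕ (block i j)           ≡⟨ toℕ-mod (toℕ i + toℕ j * t) m ⟩
      (toℕ i + toℕ j * t) % m   ≡⟨ [m+n*o]%[p*o]≡m+n%p*o (toℕ j) m′ (toℕ<n i) ⟩
      toℕ i + toℕ j % m′ * t    ≡⟨ cong (λ x → toℕ i + x * t) (m<n⇒m%n≡m (toℕ<n j)) ⟩
      toℕ i + toℕ j * t         ∎
      where open ≡-Reasoning

    block-injectiveʳ : ∀ i {j j′} → block i j ≡ block i j′ → j ≡ j′
    block-injectiveʳ i {j} {j′} eq = toℕ-injective (*-cancelʳ-≡ (toℕ j) (toℕ j′) t
      (+-cancelˡ-≡ (toℕ i) _ _ (trans (sym (toℕ-block i j)) (trans (cong toℕ eq) (toℕ-block i j′)))))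

    block-surjective : ∀ k → ∃₂ λ i j → block i j ≡ k
    block-surjective k = i , j , toℕ-injective (begin
      toℕ (block i j)       ≡⟨ toℕ-block i j ⟩
      toℕ i + toℕ j * t     ≡⟨ cong₂ (λ x y → x + y * t) (toℕ-mod k′ t) (toℕ-fromℕ< k′/t<m′) ⟩
      k′ % t + k′ / t * t   ≡⟨ m≡m%n+[m/n]*n k′ t ⟨
      k′                    ∎)
      where
      open ≡-Reasoning
      k′ = toℕ k
      k′/t<m′ : k′ / t < m′
      k′/t<m′ = m<n*o⇒m/o<n (toℕ<n k)
      i = k′ mod t
      j = fromℕ< k′/t<m′

    block-+ : ∀ c′ i j → (toℕ (block i j) + c′ * t) mod m ≡ block i ((toℕ j + c′) mod m′)
    block-+ c′ i j = toℕ-injective (begin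
      toℕ ((toℕ (block i j) + c′ * t) mod m)  ≡⟨ toℕ-mod (toℕ (block i j) + c′ * t) m ⟩
      (toℕ (block i j) + c′ * t) % m          ≡⟨ %-congˡ (cong (_+ c′ * t) (toℕ-block i j)) ⟩
      (toℕ i + toℕ j * t + c′ * t) % m        ≡⟨ %-congˡ (+-assoc (toℕ i) _ _) ⟩
      (toℕ i + (toℕ j * t + c′ * t)) % m      ≡⟨ %-congˡ (cong (toℕ i +_) (*-distribʳ-+ t (toℕ j) c′)) ⟨
      (toℕ i + (toℕ j + c′) * t) % m          ≡⟨ [m+n*o]%[p*o]≡m+n%p*o (toℕ j + c′) m′ (toℕ<n i) ⟩
      toℕ i + (toℕ j + c′) % m′ * t           ≡⟨ cong (λ x → toℕ i + x * t) (toℕ-mod (toℕ j + c′) m′) ⟨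
      toℕ i + toℕ ((toℕ j + c′) mod m′) * t   ≡⟨ toℕ-block i ((toℕ j + c′) mod m′) ⟨
      toℕ (block i ((toℕ j + c′) mod m′))     ∎)
      where open ≡-Reasoning

    module _ {l lam c′ : ℕ} (A : Fin m → Subset n) where
      D : Fin t → Fin m′ → Subset n
      D i = subfam G A t (toℕ i) m′

      fam-block : ∀ i j → fam G A (toℕ (block i j) + c′ * t) ≡ fam G (D i) (toℕ j + c′)
      fam-block i j = cong A (block-+ c′ i j)

      subfamilies-isSCEDF : IsSCEDF G m l lam (c′ * t) A →
                            ∀ i → IsSCEDF G m′ l lam c′ (D i)
      subfamilies-isSCEDF (2≤l , _ , 1≤c , c<m , disjoint , size , diff) i =
        2≤l , 2≤m′ , 1≤c′ , c′<m′ , disjointᴰ , (λ j → size (block i j)) , diffᴰ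
        where
        1≤c′ : 1 ≤ c′
        1≤c′ = 0<m*n⇒0<m c′ 1≤c
        c′<m′ : c′ < m′
        c′<m′ = *-cancelʳ-< t c′ m′ c<m
        2≤m′ : 2 ≤ m′
        2≤m′ = ≤-trans (s<s 1≤c′) c′<m′
        disjointᴰ : ∀ j j′ → j ≢ j′ → ∀ x → x ∈ D i j → x ∈ D i j′ → ⊥
        disjointᴰ j j′ j≢j′ = disjoint (block i j) (block i j′) (λ eq → j≢j′ (block-injectiveʳ i eq))
        diffᴰ : ∀ j → HasConstantDifferences lam (fam G (D i) (toℕ j + c′)) (D i j)
        diffᴰ j = subst (λ X → HasConstantDifferences lam X (D i j)) (fam-block i j) (diff (block i j))

      isSCEDF-subfamilies : (∀ i j → i ≢ j → ∀ x → x ∈ A i → x ∈ A j → ⊥) →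
                            (∀ i → IsSCEDF G m′ l lam c′ (D i)) →
                            IsSCEDF G m l lam (c′ * t) A
      isSCEDF-subfamilies disjoint isSCEDFᴰ with isSCEDFᴰ zero
      ... | 2≤l , 2≤m′ , 1≤c′ , c′<m′ , _ =
        2≤l , ≤-trans 2≤m′ (m≤m*n m′ t) , ≤-trans 1≤c′ (m≤m*n c′ t) , *-monoˡ-< t c′<m′ ,
        disjoint , size , diff
        where
        size : ∀ k → ∣ A k ∣ ≡ l
        size k with block-surjective k
        ... | i , j , refl = sizes (isSCEDFᴰ i) j
        diff : ∀ k → HasConstantDifferences lam (fam G A (toℕ k + c′ * t)) (A k)
        diff k with block-surjective k
        ... | i , j , refl =
          subst (λ X → HasConstantDifferences lam X (A (block i j))) (sym (fam-block i j))
                (differences (isSCEDFᴰ i) j)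

lemma2 : ∀ {n : ℕ} (G : FiniteAbelianGroup n) (m l lam c : ℕ)
         (A : Fin m → Subset n) →
         2 ≤ l → 2 ≤ m → 1 ≤ c → c < m →
         (∀ i j → i ≢ j → ∀ x → x ∈ A i → x ∈ A j → ⊥) →
         (∀ i → ∣ A i ∣ ≡ l) →
         (t c′ m′ : ℕ) → t ≡ gcd c m → c ≡ c′ * t → m ≡ m′ * t →
         IsSCEDF G m l lam c A
           ⇔ (∀ (i : Fin t) →
                IsSCEDF G m′ l lam c′ (subfam G A t (toℕ i) m′))
lemma2 G .(m′ * zero) l lam .(c′ * zero) A _ 2≤m _ _ _ _ zero c′ m′ _ refl refl
  with () ← subst (2 ≤_) (*-zeroʳ m′) 2≤m
lemma2 G .(zero * suc s) l lam .(c′ * suc s) A _ () _ _ _ _ (suc s) c′ zero _ refl refl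
lemma2 G .(suc r * suc s) l lam .(c′ * suc s) A _ _ _ _ disjoint _ (suc s) c′ (suc r) _ refl refl =
  mk⇔ (subfamilies-isSCEDF A) (isSCEDF-subfamilies A disjoint)
  where open Blocks G r s
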